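{- Let $\mathsf{End}$, $\mathsf{FP}$ and $\mathsf{MT}$ denote respectively the sets of twisted endofunctions, twisted parking functions and twisted packed words. Then $\mathsf{End}$, $\mathsf{FP}$ and $\mathsf{MT}$ are symmetric sub-operads of $\mathsf{T}\mathbb{N}$. Moreover, $\mathsf{MT}$ is generated, as a symmetric operad, by the words $00$ and $01$.
   Context: $\mathbb{N}$ denotes the additive monoid of nonnegative integers. $\mathsf{T}\mathbb{N} := \biguplus_{n\ge1}\mathbb{N}^n$ is the set of nonempty words over $\mathbb{N}$, a word of length $n$ having arity $n$, with partial compositions $x\circ_i y := (x_1,\dots,x_{i-1}, x_i+y_1,\dots,x_i+y_m, x_{i+1},\dots,x_n)$ for $x$ of length $n$, $y$ of length $m$, $1\le i\le n$, and symmetric group action $x\cdot\sigma := (x_{\sigma_1},\dots,x_{\sigma_n})$ for $\sigma\in\mathfrak{S}_n$; its unit is the word $0$ of length $1$. A symmetric sub-operad is a subset containing the unit and closed under all $\circ_i$ and under the symmetric group actions; the symmetric sub-operad generated by a set $G$ is the smallest such subset containing $G$. A word $u$ over $\mathbb{N}$ is a twisted endofunction (resp. twisted parking function, twisted packed word) if the word $(u_1+1,\dots,u_{|u|}+1)$ is an endofunction (resp. parking function, packed word). Here a word $w$ of length $n$ over positive integers is an endofunction if all its letters lie in $\{1,\dots,n\}$; it is a parking function if, writing its letters in nondecreasing order $v_1\le\dots\le v_n$, one has $v_i\le i$ for all $i$; it is a packed word if whenever a letter $k\ge 2$ occurs in $w$, the letter $k-1$ also occurs in $w$. -}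

module Defs where

open import Data.Nat using (ℕ; zero; suc; _+_; _≤_; _<_; _≥_; pred)
open import Data.Nat.Properties using (≤-decTotalOrder)
open import Data.Fin using (Fin; zero; suc; toℕ)
open import Data.Fin.Permutation using (Permutation′; _⟨$⟩ʳ_)
open import Data.List using (List; []; _∷_; _++_; map; length; lookup; tabulate)
open import Data.List.Membership.Propositional using (_∈_)
open import Data.Product using (_×_)
open import Data.Sum using (_⊎_)
open import Relation.Binary.PropositionalEquality using (_≡_)
import Data.List.Sort.InsertionSort.Base as ISort

-- Words over ℕ are lists; the arity of a word is its length.
-- 𝖳ℕ consists of the nonempty words.
Word : Set
Word = List ℕ

WordSet : Set₁
WordSet = Word → Set

InTN : WordSet
InTN u = 1 ≤ length u

unit : Word
unit = 0 ∷ []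

-- Partial composition  x ∘ᵢ y, with i : Fin (length x) (0-indexed position).
-- x ∘ᵢ y = (x₁,…,x_{i-1}, xᵢ+y₁,…,xᵢ+y_m, x_{i+1},…,x_n)
_∘[_]_ : (x : Word) → Fin (length x) → Word → Word
(a ∷ xs) ∘[ zero ] y = map (a +_) y ++ xs
(a ∷ xs) ∘[ suc i ] y = a ∷ (xs ∘[ i ] y)

_·_ : (x : Word) → Permutation′ (length x) → Word
x · σ = tabulate (λ j → lookup x (σ ⟨$⟩ʳ j))

record IsSymSubOperad (P : WordSet) : Set where
  field
    sub     : ∀ u → P u → InTN u
    hasUnit : P unit
    closed∘ : ∀ x y (i : Fin (length x)) → P x → P y → P (x ∘[ i ] y)
    closed· : ∀ x (σ : Permutation′ (length x)) → P x → P (x · σ)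

data Generated (G : WordSet) : WordSet where
  gen  : ∀ {u} → G u → Generated G u
  gunit : Generated G unit
  gcomp : ∀ {x y} (i : Fin (length x)) →
          Generated G x → Generated G y → Generated G (x ∘[ i ] y)
  gact : ∀ {x} (σ : Permutation′ (length x)) →
         Generated G x → Generated G (x · σ)

shift : Word → Word
shift = map suc

IsEndofunction : Word → Set
IsEndofunction w = ∀ a → a ∈ w → (1 ≤ a) × (a ≤ length w)

sortℕ : List ℕ → List ℕ
sortℕ = ISort.sort ≤-decTotalOrder

-- Parking function: word over positive integers whose sorted rearrangement
-- v₁ ≤ … ≤ vₙ satisfies vᵢ ≤ i (1-indexed; here index j : Fin n is i = j+1).
IsParkingFunction : Word → Set
IsParkingFunction w =
  (∀ a → a ∈ w → 1 ≤ a) ×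
  (∀ (j : Fin (length (sortℕ w))) → lookup (sortℕ w) j ≤ suc (toℕ j))

IsPackedWord : Word → Set
IsPackedWord w =
  (∀ a → a ∈ w → 1 ≤ a) ×
  (∀ k → k ∈ w → k ≥ 2 → pred k ∈ w)

-- Twisted versions (u is twisted-X iff shift u is X). We require u ∈ 𝖳ℕ
-- (nonempty), since these are considered as subsets of 𝖳ℕ.
End : WordSet
End u = InTN u × IsEndofunction (shift u)

FP : WordSet
FP u = InTN u × IsParkingFunction (shift u)

MT : WordSet
MT u = InTN u × IsPackedWord (shift u)

Gen₀₀₀₁ : WordSet
Gen₀₀₀₁ u = (u ≡ 0 ∷ 0 ∷ []) ⊎ (u ≡ 0 ∷ 1 ∷ [])

-- Each family is cut out of the nonempty words by a property of the
-- multiset of letters: every letter is smaller than the arity (End), for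
-- every k at least min(k+1, arity) letters are ≤ k (FP), the set of letters
-- is downward closed (MT).  Up to rearrangement, x ∘ᵢ y "splices" y into x:
-- the letter xᵢ is replaced by the shifted word xᵢ + y; and the action only
-- rearranges letters.  A property that is invariant under rearrangement,
-- stable under splicing and under the action, and true for the unit, is
-- called operadic; a generic lemma turns it into the sub-operad axioms.
--
-- For the generation statement: 00 and 01 lie in MT, hence so does every
-- word they generate.  Conversely, removing one occurrence of the largest
-- letter M from a twisted packed word of arity ≥ 2 leaves a smaller one w,
-- which contains 0 if M = 0 and M - 1 otherwise; grafting 00 at that 0, or
-- 01 at that M - 1, gives back the word up to rearrangement, and the action
-- realises every rearrangement.

module Submission where

open import Defs
open import Data.Fin using (Fin; zero; suc; toℕ; fromℕ<; cast)
open import Data.Fin.Properties using (toℕ<n; toℕ-fromℕ<; cast-is-id)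
open import Data.Fin.Permutation using (Permutation′; _⟨$⟩ʳ_; _⟨$⟩ˡ_; _∘ₚ_; inverseʳ; cast-id)
open import Data.List using ([]; _∷_; [_]; _++_; map; length; lookup; tabulate; filter; removeAt)
open import Data.List.Extrema.Nat using (max; argmax-sel; ⊥≤max; xs≤max)
open import Data.List.Membership.Propositional using (_∈_)
open import Data.List.Membership.Propositional.Properties
  using (∈-map⁺; ∈-map⁻; ∈-++⁺ˡ; ∈-++⁺ʳ; ∈-++⁻; ∈-lookup; ∈-tabulate⁺; ∈-tabulate⁻)
open import Data.List.Properties
  using (length-++; length-map; length-tabulate; length-filter; filter-++; filter-accept;
         filter-reject; filter-all; filter-none; filter-notAll; tabulate-cong; tabulate-lookup)
open import Data.List.Relation.Binary.Permutation.Propositional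
  using (_↭_; ↭-refl; ↭-prep; ↭-swap; ↭-trans; ↭-sym; ↭⇒↭ₛ; module PermutationReasoning)
open import Data.List.Relation.Binary.Permutation.Propositional.Properties
  using (↭-length; ∈-resp-↭; filter-↭) renaming (shift to ↭-shift)
import Data.List.Relation.Binary.Permutation.Setoid.Properties as SetoidPermutation
open import Data.List.Relation.Unary.All as All using (All; _∷_)
open import Data.List.Relation.Unary.All.Properties using (map⁺)
open import Data.List.Relation.Unary.Any as Any using (here; there; index)
open import Data.List.Relation.Unary.Any.Properties using (lookup-index)
open import Data.List.Relation.Unary.Linked using (Linked)
import Data.List.Relation.Unary.Linked as Linked
open import Data.List.Relation.Unary.Linked.Properties using (Linked⇒All)
import Data.List.Sort.InsertionSort.Properties as InsertionSort
open import Data.Nat using (ℕ; zero; suc; _+_; _∸_; _≤_; _<_; z≤n; s≤s; _≤?_; _<?_; pred)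
open import Data.Nat.Properties
open import Data.Product using (Σ; _×_; _,_; proj₁; proj₂)
open import Data.Sum using (_⊎_; inj₁; inj₂; reduce)
open import Function using (id; _∘_)
open import Relation.Binary.PropositionalEquality
  using (_≡_; refl; sym; trans; cong; subst; subst₂; setoid; module ≡-Reasoning)
open import Relation.Nullary using (¬_; yes; no; contradiction)
open import Algebra.Properties.CommutativeMonoid.Sum +-0-commutativeMonoid using (sum; sum-permute)

open import Data.List.Relation.Binary.Permutation.Setoid (setoid ℕ)
  using (onIndices) renaming (_↭_ to _↭ₛ_)
open SetoidPermutation (setoid ℕ) using (onIndices-lookup)
open InsertionSort ≤-decTotalOrder using (sort-↭; sort-↗)

-- Rearrangements, composition and action

pick-↭ : ∀ (x : Word) i → x ↭ lookup x i ∷ removeAt x i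
pick-↭ (a ∷ x) zero    = ↭-refl
pick-↭ (a ∷ x) (suc i) = ↭-trans (↭-prep a (pick-↭ x i)) (↭-swap a (lookup x i) ↭-refl)

∘-↭ : ∀ x i y → x ∘[ i ] y ↭ map (lookup x i +_) y ++ removeAt x i
∘-↭ (a ∷ x) zero    y = ↭-refl
∘-↭ (a ∷ x) (suc i) y =
  ↭-trans (↭-prep a (∘-↭ x i y)) (↭-sym (↭-shift a (map (lookup x i +_) y) (removeAt x i)))

length-splice : ∀ a y R → length (map (a +_) y ++ R) ≡ length y + length R
length-splice a y R = trans (length-++ (map (a +_) y)) (cong (_+ length R) (length-map (a +_) y))

length-· : ∀ x (σ : Permutation′ (length x)) → length (x · σ) ≡ length x
length-· x σ = length-tabulate (λ j → lookup x (σ ⟨$⟩ʳ j))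

∈-·⁻ : ∀ {a} x (σ : Permutation′ (length x)) → a ∈ x · σ → a ∈ x
∈-·⁻ x σ a∈xσ with ∈-tabulate⁻ a∈xσ
... | j , refl = ∈-lookup (σ ⟨$⟩ʳ j)

∈-·⁺ : ∀ {a} x (σ : Permutation′ (length x)) → a ∈ x → a ∈ x · σ
∈-·⁺ {a} x σ a∈x = subst (_∈ x · σ) moved (∈-tabulate⁺ (σ ⟨$⟩ˡ index a∈x))
  where
  moved : lookup x (σ ⟨$⟩ʳ (σ ⟨$⟩ˡ index a∈x)) ≡ a
  moved = trans (cong (lookup x) (inverseʳ σ)) (sym (lookup-index a∈x))

-- Conversely every rearrangement of a word is realised by the action: the
-- rearrangement induces a permutation of positions, which we transport
-- along the equality of lengths.
tabulate-lookup-cast : ∀ {n} (ys : Word) (e : n ≡ length ys) →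
                       tabulate (λ j → lookup ys (cast e j)) ≡ ys
tabulate-lookup-cast ys refl =
  trans (tabulate-cong (λ j → cong (lookup ys) (cast-is-id refl j))) (tabulate-lookup ys)

↭⇒· : ∀ {xs ys : Word} → xs ↭ ys → Σ (Permutation′ (length xs)) λ σ → xs · σ ≡ ys
↭⇒· {xs} {ys} xs↭ys = cast-id lengths ∘ₚ onIndices ys↭xs , realised
  where
  lengths : length xs ≡ length ys
  lengths = ↭-length xs↭ys
  ys↭xs : ys ↭ₛ xs
  ys↭xs = ↭⇒↭ₛ (↭-sym xs↭ys)
  realised : tabulate (λ j → lookup xs (onIndices ys↭xs ⟨$⟩ʳ cast lengths j)) ≡ ys
  realised = trans (tabulate-cong (λ j → sym (onIndices-lookup ys↭xs (cast lengths j))))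
                   (tabulate-lookup-cast ys lengths)

-- Counting small letters

cnt : ℕ → Word → ℕ
cnt t u = length (filter (_≤? t) u)

cnt-++ : ∀ t xs ys → cnt t (xs ++ ys) ≡ cnt t xs + cnt t ys
cnt-++ t xs ys = trans (cong length (filter-++ (_≤? t) xs ys)) (length-++ (filter (_≤? t) xs))

cnt-↭ : ∀ t {xs ys} → xs ↭ ys → cnt t xs ≡ cnt t ys
cnt-↭ t xs↭ys = ↭-length (filter-↭ (_≤? t) xs↭ys)

cnt≤length : ∀ t u → cnt t u ≤ length u
cnt≤length t = length-filter (_≤? t)

cnt-∷-≤ : ∀ {t a} u → a ≤ t → cnt t (a ∷ u) ≡ suc (cnt t u)
cnt-∷-≤ {t} u a≤t = cong length (filter-accept (_≤? t) {xs = u} a≤t)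

cnt-∷-> : ∀ {t a} u → ¬ a ≤ t → cnt t (a ∷ u) ≡ cnt t u
cnt-∷-> {t} u a≰t = cong length (filter-reject (_≤? t) {xs = u} a≰t)

cnt-none : ∀ {t u} → All (λ a → ¬ a ≤ t) u → cnt t u ≡ 0
cnt-none {t} none = cong length (filter-none (_≤? t) none)

cnt-all : ∀ {t u} → All (_≤ t) u → cnt t u ≡ length u
cnt-all {t} all = cong length (filter-all (_≤? t) all)

cnt<length : ∀ {t a u} → a ∈ u → ¬ a ≤ t → cnt t u < length u
cnt<length {t} a∈u a≰t = filter-notAll (_≤? t) _ (Any.map (λ { refl → a≰t }) a∈u)

cnt-map : ∀ {t t'} (f : ℕ → ℕ) → (∀ a → a ≤ t' → f a ≤ t) → (∀ a → f a ≤ t → a ≤ t') →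
          ∀ u → cnt t (map f u) ≡ cnt t' u
cnt-map f _ _ [] = refl
cnt-map {t} {t'} f preserves reflects (a ∷ u) with a ≤? t'
... | yes a≤t' = trans (cnt-∷-≤ (map f u) (preserves a a≤t'))
                       (trans (cong suc (cnt-map f preserves reflects u)) (sym (cnt-∷-≤ u a≤t')))
... | no a≰t'  = trans (cnt-∷-> (map f u) (a≰t' ∘ reflects a))
                       (trans (cnt-map f preserves reflects u) (sym (cnt-∷-> u a≰t')))

cnt-mono : ∀ {t t'} → t ≤ t' → ∀ u → cnt t u ≤ cnt t' u
cnt-mono t≤t' [] = z≤n
cnt-mono {t} {t'} t≤t' (a ∷ u) with a ≤? t
... | yes a≤t = begin
  cnt t (a ∷ u)           ≡⟨ cnt-∷-≤ u a≤t ⟩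
  suc (cnt t u)           ≤⟨ s≤s (cnt-mono t≤t' u) ⟩
  suc (cnt t' u)          ≡⟨ cnt-∷-≤ u (≤-trans a≤t t≤t') ⟨
  cnt t' (a ∷ u)          ∎
  where open ≤-Reasoning
... | no a≰t = begin
  cnt t (a ∷ u)           ≡⟨ cnt-∷-> u a≰t ⟩
  cnt t u                 ≤⟨ cnt-mono t≤t' u ⟩
  cnt t' u                ≤⟨ m≤n+m (cnt t' u) (cnt t' [ a ]) ⟩
  cnt t' [ a ] + cnt t' u ≡⟨ cnt-++ t' [ a ] u ⟨
  cnt t' (a ∷ u)          ∎
  where open ≤-Reasoning

cnt-tabulate : ∀ t {n} (f : Fin n → ℕ) → cnt t (tabulate f) ≡ sum (λ j → cnt t [ f j ])
cnt-tabulate t {zero}  f = refl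
cnt-tabulate t {suc n} f =
  trans (cnt-++ t [ f zero ] (tabulate (f ∘ suc)))
        (cong (cnt t [ f zero ] +_) (cnt-tabulate t (f ∘ suc)))

cnt-· : ∀ t x (σ : Permutation′ (length x)) → cnt t (x · σ) ≡ cnt t x
cnt-· t x σ = begin
  cnt t (x · σ)                              ≡⟨ cnt-tabulate t (λ j → lookup x (σ ⟨$⟩ʳ j)) ⟩
  sum (λ j → cnt t [ lookup x (σ ⟨$⟩ʳ j) ]) ≡⟨ sum-permute (λ j → cnt t [ lookup x j ]) σ ⟨
  sum (λ j → cnt t [ lookup x j ])           ≡⟨ cnt-tabulate t (lookup x) ⟨
  cnt t (tabulate (lookup x))                ≡⟨ cong (cnt t) (tabulate-lookup x) ⟩
  cnt t x                                    ∎
  where open ≡-Reasoning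

-- Operadic properties

record OperadicProperty (Q : WordSet) : Set where
  field
    resp-↭  : ∀ {xs ys} → xs ↭ ys → Q xs → Q ys
    unit∈   : Q unit
    splice∈ : ∀ a R y → Q (a ∷ R) → InTN y → Q y → Q (map (a +_) y ++ R)
    action∈ : ∀ x σ → Q x → Q (x · σ)

  -- Composition is a splice followed by a rearrangement.
  composition∈ : ∀ x i y → Q x → InTN y → Q y → Q (x ∘[ i ] y)
  composition∈ x i y Qx nonempty-y Qy =
    resp-↭ (↭-sym (∘-↭ x i y))
           (splice∈ (lookup x i) (removeAt x i) y (resp-↭ (pick-↭ x i) Qx) nonempty-y Qy)

nonempty-operadic : OperadicProperty InTN
nonempty-operadic = record
  { resp-↭  = λ xs↭ys 1≤xs → subst (1 ≤_) (↭-length xs↭ys) 1≤xs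
  ; unit∈   = s≤s z≤n
  ; splice∈ = λ a R y _ 1≤y _ → subst (1 ≤_) (sym (length-splice a y R)) (≤-trans 1≤y (m≤m+n _ _))
  ; action∈ = λ x σ 1≤x → subst (1 ≤_) (sym (length-· x σ)) 1≤x
  }

subOperad : ∀ {P Q : WordSet} → OperadicProperty Q →
            (∀ u → P u → InTN u × Q u) → (∀ u → InTN u → Q u → P u) → IsSymSubOperad P
subOperad Q-operadic P⇒Q Q⇒P = record
  { sub     = λ u → proj₁ ∘ P⇒Q u
  ; hasUnit = Q⇒P unit N.unit∈ O.unit∈
  ; closed∘ = λ x y i Px Py →
      let (1≤x , Qx) = P⇒Q x Px ; (1≤y , Qy) = P⇒Q y Py
      in Q⇒P (x ∘[ i ] y) (N.composition∈ x i y 1≤x 1≤y 1≤y) (O.composition∈ x i y Qx 1≤y Qy)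
  ; closed· = λ x σ Px →
      let (1≤x , Qx) = P⇒Q x Px
      in Q⇒P (x · σ) (N.action∈ x σ 1≤x) (O.action∈ x σ Qx)
  }
  where
  module N = OperadicProperty nonempty-operadic
  module O = OperadicProperty Q-operadic

shifted-positive : ∀ {a} u → a ∈ shift u → 1 ≤ a
shifted-positive u a∈su with ∈-map⁻ suc a∈su
... | _ , _ , refl = s≤s z≤n

∈-shift⁻ : ∀ {a} u → suc a ∈ shift u → a ∈ u
∈-shift⁻ u sa∈su with ∈-map⁻ suc sa∈su
... | _ , a∈u , refl = a∈u

-- Twisted endofunctions

Bounded : WordSet
Bounded u = ∀ {a} → a ∈ u → a < length u

End⇒bounded : ∀ u → End u → InTN u × Bounded u
End⇒bounded u (1≤u , endo) = 1≤u , λ a∈u →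
  subst (suc _ ≤_) (length-map suc u) (proj₂ (endo _ (∈-map⁺ suc a∈u)))

bounded⇒End : ∀ u → InTN u → Bounded u → End u
bounded⇒End u 1≤u bounded = 1≤u , endo
  where
  endo : IsEndofunction (shift u)
  endo _ sa∈su with ∈-map⁻ suc sa∈su
  ... | a , a∈u , refl = s≤s z≤n , subst (suc a ≤_) (sym (length-map suc u)) (bounded a∈u)

-- Splicing y (letters b < |y|) in place of a ≤ |R| gives letters a + b < |y| + |R|.
bounded-splice : ∀ a R y → Bounded (a ∷ R) → InTN y → Bounded y → Bounded (map (a +_) y ++ R)
bounded-splice a R y bounded-x 1≤y bounded-y {c} c∈spliced =
  subst (c <_) (sym (length-splice a y R)) (bound (∈-++⁻ (map (a +_) y) c∈spliced))
  where
  bound : c ∈ map (a +_) y ⊎ c ∈ R → c < length y + length R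
  bound (inj₁ c∈ay) with ∈-map⁻ (a +_) c∈ay
  ... | b , b∈y , refl =
    subst (a + b <_) (+-comm (length R) (length y))
          (+-mono-≤-< (≤-pred (bounded-x (here refl))) (bounded-y b∈y))
  bound (inj₂ c∈R) = ≤-trans (bounded-x (there c∈R)) (+-monoˡ-≤ (length R) 1≤y)

bounded-operadic : OperadicProperty Bounded
bounded-operadic = record
  { resp-↭  = λ xs↭ys bounded a∈ys →
      subst (_ <_) (↭-length xs↭ys) (bounded (∈-resp-↭ (↭-sym xs↭ys) a∈ys))
  ; unit∈   = λ { (here refl) → s≤s z≤n }
  ; splice∈ = bounded-splice
  ; action∈ = λ x σ bounded a∈xσ → subst (_ <_) (sym (length-· x σ)) (bounded (∈-·⁻ x σ a∈xσ))
  }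

-- Twisted packed words

DownClosed : WordSet
DownClosed u = ∀ {k} → suc k ∈ u → k ∈ u

MT⇒downClosed : ∀ u → MT u → InTN u × DownClosed u
MT⇒downClosed u (1≤u , _ , packed) = 1≤u , λ sk∈u →
  ∈-shift⁻ u (packed _ (∈-map⁺ suc sk∈u) (s≤s (s≤s z≤n)))

downClosed⇒MT : ∀ u → InTN u → DownClosed u → MT u
downClosed⇒MT u 1≤u downClosed = 1≤u , (λ _ → shifted-positive u) , packed
  where
  packed : ∀ k → k ∈ shift u → 2 ≤ k → pred k ∈ shift u
  packed (suc (suc k)) ssk∈su _         = ∈-map⁺ suc (downClosed (∈-shift⁻ u ssk∈su))
  packed (suc zero)    _      (s≤s ())

zero∈ : ∀ {k u} → DownClosed u → k ∈ u → 0 ∈ u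
zero∈ {zero}  downClosed 0∈u  = 0∈u
zero∈ {suc k} downClosed sk∈u = zero∈ downClosed (downClosed sk∈u)

-- Since 0 ∈ y, the letter a survives in a + y; letters a + (b+1) step down
-- to a + b, and a + 0 = a steps down inside a ∷ R.
downClosed-splice : ∀ a R y → DownClosed (a ∷ R) → InTN y → DownClosed y →
                    DownClosed (map (a +_) y ++ R)
downClosed-splice a R (b ∷ y) downClosed-x _ downClosed-y {k} sk∈spliced =
  step (∈-++⁻ (map (a +_) (b ∷ y)) sk∈spliced)
  where
  from-x : ∀ {c} → c ∈ a ∷ R → c ∈ map (a +_) (b ∷ y) ++ R
  from-x (here refl) = ∈-++⁺ˡ (subst (_∈ map (a +_) (b ∷ y)) (+-identityʳ a)
                                      (∈-map⁺ (a +_) (zero∈ downClosed-y (here refl))))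
  from-x (there c∈R) = ∈-++⁺ʳ (map (a +_) (b ∷ y)) c∈R
  step : suc k ∈ map (a +_) (b ∷ y) ⊎ suc k ∈ R → k ∈ map (a +_) (b ∷ y) ++ R
  step (inj₂ sk∈R) = from-x (downClosed-x (there sk∈R))
  step (inj₁ sk∈ay) with ∈-map⁻ (a +_) sk∈ay
  ... | zero , _ , sk≡a+0 =
    from-x (downClosed-x (here (trans sk≡a+0 (+-identityʳ a))))
  ... | suc c , sc∈y , sk≡a+sc =
    subst (_∈ _) (suc-injective (sym (trans sk≡a+sc (+-suc a c))))
          (∈-++⁺ˡ (∈-map⁺ (a +_) (downClosed-y sc∈y)))

downClosed-operadic : OperadicProperty DownClosed
downClosed-operadic = record
  { resp-↭  = λ xs↭ys downClosed sk∈ys →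
      ∈-resp-↭ xs↭ys (downClosed (∈-resp-↭ (↭-sym xs↭ys) sk∈ys))
  ; unit∈   = λ { (here ()) ; (there ()) }
  ; splice∈ = downClosed-splice
  ; action∈ = λ x σ downClosed sk∈xσ → ∈-·⁺ x σ (downClosed (∈-·⁻ x σ sk∈xσ))
  }

-- Twisted parking functions

-- The parking condition at k for a word of arity n having c letters ≤ k:
-- at least min(k + 1, n) letters are ≤ k.
ParkingAt : ℕ → ℕ → ℕ → Set
ParkingAt k n c = suc k ≤ c ⊎ n ≤ c

ParkingAt-cong : ∀ {k n n' c c'} → n ≡ n' → c ≡ c' → ParkingAt k n c → ParkingAt k n' c'
ParkingAt-cong refl refl parkingAt = parkingAt

Parking : WordSet
Parking u = ∀ k → ParkingAt k (length u) (cnt k u)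

Sorted : Word → Set
Sorted = Linked _≤_

sorted-head≤ : ∀ {a s} → Sorted (a ∷ s) → All (a ≤_) (a ∷ s)
sorted-head≤ sorted = Linked⇒All ≤-trans ≤-refl sorted

sorted-count⁺ : ∀ {t} s → Sorted s → (j : Fin (length s)) → lookup s j ≤ t → suc (toℕ j) ≤ cnt t s
sorted-count⁺ {t} (a ∷ s) sorted j sⱼ≤t = subst (suc (toℕ j) ≤_) (sym (cnt-∷-≤ s a≤t)) (counted j sⱼ≤t)
  where
  a≤t : a ≤ t
  a≤t = ≤-trans (All.lookup (sorted-head≤ sorted) (∈-lookup j)) sⱼ≤t
  counted : ∀ j → lookup (a ∷ s) j ≤ t → suc (toℕ j) ≤ suc (cnt t s)
  counted zero    _    = s≤s z≤n
  counted (suc j) sⱼ≤t = s≤s (sorted-count⁺ s (Linked.tail sorted) j sⱼ≤t)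

sorted-count⁻ : ∀ {t} s → Sorted s → (j : Fin (length s)) → suc (toℕ j) ≤ cnt t s → lookup s j ≤ t
sorted-count⁻ {t} (a ∷ s) sorted j enough with a ≤? t
sorted-count⁻ {t} (a ∷ s) sorted zero    enough | yes a≤t = a≤t
sorted-count⁻ {t} (a ∷ s) sorted (suc j) enough | yes a≤t =
  sorted-count⁻ s (Linked.tail sorted) j (≤-pred (subst (suc (suc (toℕ j)) ≤_) (cnt-∷-≤ s a≤t) enough))
sorted-count⁻ {t} (a ∷ s) sorted j       enough | no a≰t  =
  contradiction (subst (suc (toℕ j) ≤_) (cnt-none none) enough) λ ()
  where
  none : All (λ b → ¬ b ≤ t) (a ∷ s)
  none = All.map (λ a≤b b≤t → a≰t (≤-trans a≤b b≤t)) (sorted-head≤ sorted)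

sortedShift : Word → Word
sortedShift u = sortℕ (shift u)

cnt-sortedShift : ∀ k u → cnt (suc k) (sortedShift u) ≡ cnt k u
cnt-sortedShift k u =
  trans (cnt-↭ (suc k) (sort-↭ (shift u))) (cnt-map suc (λ _ → s≤s) (λ _ → ≤-pred) u)

length-sortedShift : ∀ u → length (sortedShift u) ≡ length u
length-sortedShift u = trans (↭-length (sort-↭ (shift u))) (length-map suc u)

FP⇒parking : ∀ u → FP u → InTN u × Parking u
FP⇒parking u (1≤u , _ , bound) = 1≤u , parking
  where
  s : Word
  s = sortedShift u
  parking : Parking u
  parking k with k <? length s
  ... | yes k<n = inj₁ (subst₂ (λ i c → suc i ≤ c) (toℕ-fromℕ< k<n) (cnt-sortedShift k u)
                         (sorted-count⁺ s (sort-↗ (shift u)) j sⱼ≤k+1))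
    where
    j : Fin (length s)
    j = fromℕ< k<n
    sⱼ≤k+1 : lookup s j ≤ suc k
    sⱼ≤k+1 = subst (λ i → lookup s j ≤ suc i) (toℕ-fromℕ< k<n) (bound j)
  ... | no k≮n = inj₂ (≤-reflexive (trans (sym (length-sortedShift u))
                                         (trans (sym (cnt-all all≤)) (cnt-sortedShift k u))))
    where
    all≤ : All (_≤ suc k) s
    all≤ = All.tabulate λ a∈s → subst (_≤ suc k) (sym (lookup-index a∈s))
      (≤-trans (bound (index a∈s)) (s≤s (<⇒≤ (≤-trans (toℕ<n (index a∈s)) (≮⇒≥ k≮n)))))

parking⇒FP : ∀ u → InTN u → Parking u → FP u
parking⇒FP u 1≤u parking = 1≤u , (λ _ → shifted-positive u) , bound
  where
  s : Word
  s = sortedShift u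
  bound : ∀ j → lookup s j ≤ suc (toℕ j)
  bound j = sorted-count⁻ s (sort-↗ (shift u)) j
    (subst (suc (toℕ j) ≤_) (sym (cnt-sortedShift (toℕ j) u)) (enough (parking (toℕ j))))
    where
    enough : ParkingAt (toℕ j) (length u) (cnt (toℕ j) u) → suc (toℕ j) ≤ cnt (toℕ j) u
    enough (inj₁ j<c) = j<c
    enough (inj₂ n≤c) = ≤-trans (subst (suc (toℕ j) ≤_) (length-sortedShift u) (toℕ<n j)) n≤c

-- Every twisted parking function is a twisted endofunction: a letter a ≥ n
-- would leave fewer than n letters ≤ n - 1.
parking⇒bounded : ∀ {u} → Parking u → Bounded u
parking⇒bounded {b ∷ u} parking {a} a∈u with a <? suc (length u)
... | yes a<n = a<n
... | no a≮n  = contradiction (reduce (parking (length u)))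
                              (<⇒≱ (cnt<length a∈u (λ a≤n-1 → a≮n (s≤s a≤n-1))))

parking-letter : ∀ {u a} → Parking u → a ∈ u → suc a ≤ cnt a u
parking-letter {a = a} parking a∈u with parking a
... | inj₁ enough = enough
... | inj₂ all    = ≤-trans (parking⇒bounded parking a∈u) all

-- The arithmetic of splicing y in place of a letter a ≤ k of x = a ∷ R, where
-- r = cnt k R, n = |R|, m = |y| and B = cnt (k - a) y.
splice-count : ∀ {a k r n m B} → a ≤ k → a ≤ r → 1 ≤ m →
               ParkingAt k (suc n) (suc r) → ParkingAt (k ∸ a) m B → ParkingAt k (m + n) (B + r)
splice-count {a} {k} {r} {B = B} a≤k a≤r _ _ (inj₁ k-a<B) = inj₁ (begin
  suc k           ≡⟨ cong suc (m∸n+n≡m a≤k) ⟨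
  suc (k ∸ a) + a ≤⟨ +-mono-≤ k-a<B a≤r ⟩
  B + r           ∎)
  where open ≤-Reasoning
splice-count _ _ 1≤m (inj₁ k<r+1) (inj₂ m≤B) = inj₁ (+-mono-≤ (≤-trans 1≤m m≤B) (≤-pred k<r+1))
splice-count _ _ _   (inj₂ n<r+1) (inj₂ m≤B) = inj₂ (+-mono-≤ m≤B (≤-pred n<r+1))

cnt-shifted-copy : ∀ {a k} y → a ≤ k → cnt k (map (a +_) y) ≡ cnt (k ∸ a) y
cnt-shifted-copy {a} {k} y a≤k = cnt-map (a +_)
  (λ b b≤k-a → subst (_≤ k) (+-comm b a) (m≤o∸n⇒m+n≤o b a≤k b≤k-a))
  (λ b a+b≤k → m+n≤o⇒m≤o∸n b (subst (_≤ k) (+-comm a b) a+b≤k)) y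

parking-splice : ∀ a R y → Parking (a ∷ R) → InTN y → Parking y → Parking (map (a +_) y ++ R)
parking-splice a R y parking-x 1≤y parking-y k with a ≤? k
... | yes a≤k = ParkingAt-cong (sym (length-splice a y R)) (sym count)
                  (splice-count a≤k a≤r 1≤y (ParkingAt-cong refl (cnt-∷-≤ R a≤k) (parking-x k))
                                (parking-y (k ∸ a)))
  where
  count : cnt k (map (a +_) y ++ R) ≡ cnt (k ∸ a) y + cnt k R
  count = trans (cnt-++ k (map (a +_) y) R) (cong (_+ cnt k R) (cnt-shifted-copy y a≤k))
  a≤r : a ≤ cnt k R
  a≤r = ≤-pred (begin
    suc a              ≤⟨ parking-letter parking-x (here refl) ⟩
    cnt a (a ∷ R)      ≤⟨ cnt-mono a≤k (a ∷ R) ⟩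
    cnt k (a ∷ R)      ≡⟨ cnt-∷-≤ R a≤k ⟩
    suc (cnt k R)      ∎)
    where open ≤-Reasoning
... | no a≰k = ParkingAt-cong (sym (length-splice a y R)) (sym count)
                 (inj₁ (fromR (ParkingAt-cong refl (cnt-∷-> R a≰k) (parking-x k))))
  where
  too-large : ∀ b → ¬ a + b ≤ k
  too-large b a+b≤k = a≰k (≤-trans (m≤m+n a b) a+b≤k)
  count : cnt k (map (a +_) y ++ R) ≡ 0 + cnt k R
  count = trans (cnt-++ k (map (a +_) y) R)
                (cong (_+ cnt k R) (cnt-none (map⁺ (All.universal too-large y))))
  fromR : ParkingAt k (suc (length R)) (cnt k R) → suc k ≤ cnt k R
  fromR (inj₁ k<r) = k<r
  fromR (inj₂ n<r) = contradiction (cnt≤length k R) (<⇒≱ n<r)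

parking-operadic : OperadicProperty Parking
parking-operadic = record
  { resp-↭  = λ xs↭ys parking k → ParkingAt-cong (↭-length xs↭ys) (cnt-↭ k xs↭ys) (parking k)
  ; unit∈   = λ k → inj₂ (≤-reflexive (sym (cnt-∷-≤ {k} [] z≤n)))
  ; splice∈ = parking-splice
  ; action∈ = λ x σ parking k → ParkingAt-cong (sym (length-· x σ)) (sym (cnt-· k x σ)) (parking k)
  }

-- Generation of the twisted packed words by 00 and 01

generated⊆ : ∀ {G P : WordSet} → IsSymSubOperad P → (∀ u → G u → P u) → ∀ u → Generated G u → P u
generated⊆ P-operad G⊆P u (gen Gu)         = G⊆P u Gu
generated⊆ P-operad G⊆P _ gunit            = IsSymSubOperad.hasUnit P-operad
generated⊆ P-operad G⊆P _ (gcomp i gx gy)  =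
  IsSymSubOperad.closed∘ P-operad _ _ i (generated⊆ P-operad G⊆P _ gx) (generated⊆ P-operad G⊆P _ gy)
generated⊆ P-operad G⊆P _ (gact σ gx)      =
  IsSymSubOperad.closed· P-operad _ σ (generated⊆ P-operad G⊆P _ gx)

generated-↭ : ∀ {G xs ys} → xs ↭ ys → Generated G xs → Generated G ys
generated-↭ {G} xs↭ys gxs with ↭⇒· xs↭ys
... | σ , xsσ≡ys = subst (Generated G) xsσ≡ys (gact σ gxs)

graft-↭ : ∀ w j d → w ∘[ j ] (0 ∷ d ∷ []) ↭ (lookup w j + d) ∷ w
graft-↭ w j d = begin
  w ∘[ j ] (0 ∷ d ∷ [])       ↭⟨ ∘-↭ w j (0 ∷ d ∷ []) ⟩
  c + 0 ∷ c + d ∷ R           ↭⟨ ↭-swap (c + 0) (c + d) ↭-refl ⟩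
  c + d ∷ c + 0 ∷ R           ≡⟨ cong (λ c′ → c + d ∷ c′ ∷ R) (+-identityʳ c) ⟩
  c + d ∷ c ∷ R               ↭⟨ ↭-prep (c + d) (↭-sym (pick-↭ w j)) ⟩
  c + d ∷ w                   ∎
  where
  open PermutationReasoning
  c : ℕ
  c = lookup w j
  R : Word
  R = removeAt w j

extend : ∀ {d w c} → Gen₀₀₀₁ (0 ∷ d ∷ []) → Generated Gen₀₀₀₁ w → c ∈ w → Generated Gen₀₀₀₁ (c + d ∷ w)
extend {d} {w} generator gw c∈w =
  subst (λ c → Generated Gen₀₀₀₁ (c + d ∷ w)) (sym (lookup-index c∈w))
        (generated-↭ (graft-↭ w (index c∈w) d) (gcomp (index c∈w) gw (gen generator)))

largest : ∀ a u → Σ ℕ λ M → M ∈ a ∷ u × All (_≤ M) (a ∷ u)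
largest a u = max a u , chosen (argmax-sel id a u) , ⊥≤max a u ∷ xs≤max a u
  where
  chosen : max a u ≡ a ⊎ max a u ∈ u → max a u ∈ a ∷ u
  chosen (inj₁ M≡a) = here M≡a
  chosen (inj₂ M∈u) = there M∈u

remove-largest : ∀ {u M w} → DownClosed u → u ↭ M ∷ w → All (_≤ M) u → DownClosed w
remove-largest {u} {M} {w} downClosed u↭Mw all≤M {k} sk∈w = kept (∈-resp-↭ u↭Mw (downClosed sk∈u))
  where
  sk∈u : suc k ∈ u
  sk∈u = ∈-resp-↭ (↭-sym u↭Mw) (there sk∈w)
  kept : k ∈ M ∷ w → k ∈ w
  kept (here refl) = contradiction (All.lookup all≤M sk∈u) (n≮n M)
  kept (there k∈w) = k∈w

-- A down-closed word u ↭ M ∷ w with largest letter M is obtained from w by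
-- grafting: 00 at a letter 0 of w if M = 0, and 01 at the letter M - 1
-- (which lies in u, hence in w) otherwise.
regrow : ∀ {M w u} → DownClosed u → u ↭ M ∷ w → All (_≤ M) u → InTN w →
         Generated Gen₀₀₀₁ w → Generated Gen₀₀₀₁ (M ∷ w)
regrow {w = []} _ _ _ () _
regrow {zero} {c ∷ w} _ u↭Mw all≤M _ gw =
  subst (λ c′ → Generated Gen₀₀₀₁ (c′ ∷ c ∷ w)) c+0≡0 (extend (inj₁ refl) gw (here refl))
  where
  c+0≡0 : c + 0 ≡ 0
  c+0≡0 = trans (+-identityʳ c)
                (n≤0⇒n≡0 (All.lookup all≤M (∈-resp-↭ (↭-sym u↭Mw) (there (here refl)))))
regrow {suc m} {w} downClosed u↭Mw _ _ gw
  with ∈-resp-↭ u↭Mw (downClosed (∈-resp-↭ (↭-sym u↭Mw) (here refl)))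
... | here m≡1+m = contradiction (sym m≡1+m) 1+n≢n
... | there m∈w  = subst (λ c → Generated Gen₀₀₀₁ (c ∷ w)) (+-comm m 1) (extend (inj₂ refl) gw m∈w)

single-letter : ∀ a → DownClosed [ a ] → [ a ] ≡ unit
single-letter zero    _          = refl
single-letter (suc k) downClosed with downClosed (here refl)
... | here k≡1+k = contradiction (sym k≡1+k) 1+n≢n

downClosed⇒generated : ∀ n u → length u ≡ suc n → DownClosed u → Generated Gen₀₀₀₁ u
downClosed⇒generated zero    (a ∷ []) refl downClosed =
  subst (Generated Gen₀₀₀₁) (sym (single-letter a downClosed)) gunit
downClosed⇒generated (suc n) (a ∷ u)  len  downClosed with largest a u
... | M , M∈u , all≤M =
  generated-↭ (↭-sym u↭Mw)
    (regrow downClosed u↭Mw all≤M 1≤w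
      (downClosed⇒generated n w length-w (remove-largest downClosed u↭Mw all≤M)))
  where
  w : Word
  w = removeAt (a ∷ u) (index M∈u)
  u↭Mw : a ∷ u ↭ M ∷ w
  u↭Mw = subst (λ c → a ∷ u ↭ c ∷ w) (sym (lookup-index M∈u)) (pick-↭ (a ∷ u) (index M∈u))
  length-w : length w ≡ suc n
  length-w = suc-injective (trans (sym (↭-length u↭Mw)) len)
  1≤w : InTN w
  1≤w = subst (1 ≤_) (sym length-w) (s≤s z≤n)

MT⇒generated : ∀ u → MT u → Generated Gen₀₀₀₁ u
MT⇒generated (a ∷ u) MTu =
  downClosed⇒generated (length u) (a ∷ u) refl (proj₂ (MT⇒downClosed (a ∷ u) MTu))

generators∈MT : ∀ u → Gen₀₀₀₁ u → MT u
generators∈MT _ (inj₁ refl) = downClosed⇒MT _ (s≤s z≤n)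
  λ { (here ()) ; (there (here ())) ; (there (there ())) }
generators∈MT _ (inj₂ refl) = downClosed⇒MT _ (s≤s z≤n)
  λ { (here ()) ; (there (here refl)) → here refl ; (there (there ())) }

End-operad : IsSymSubOperad End
End-operad = subOperad bounded-operadic End⇒bounded bounded⇒End

FP-operad : IsSymSubOperad FP
FP-operad = subOperad parking-operadic FP⇒parking parking⇒FP

MT-operad : IsSymSubOperad MT
MT-operad = subOperad downClosed-operadic MT⇒downClosed downClosed⇒MT

mainTheorem2 : IsSymSubOperad End × IsSymSubOperad FP × IsSymSubOperad MT ×
                 (∀ u → MT u → Generated Gen₀₀₀₁ u) × (∀ u → Generated Gen₀₀₀₁ u → MT u)
mainTheorem2 = End-operad , FP-operad , MT-operad , MT⇒generated , generated⊆ MT-operad generators∈MT
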